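{- LPO is equivalent to the statement that the transitive closure of a decidable relation $R\subseteq\mathbb{N}\times\mathbb{N}$ is again decidable.
   Context: Work in Bishop-style constructive mathematics: intuitionistic logic with countable and dependent choice; "equivalent" means mutual implication over this base. LPO: for every binary sequence $(a_n)_{n\ge1}$, either $a_n=0$ for all $n$, or there exists $n$ with $a_n=1$. A relation $R$ on $\mathbb{N}$ is decidable if for all $k,\ell$ either $(k,\ell)\in R$ or $(k,\ell)\notin R$. -}

module Defs where

open import Data.Nat using (ℕ)
open import Data.Bool using (Bool; true; false)
open import Data.Sum using (_⊎_)
open import Data.Product using (∃)
open import Relation.Binary.PropositionalEquality using (_≡_)
open import Relation.Binary.Core using (Rel)
open import Level using (0ℓ)
open import Relation.Binary.Definitions using (Decidable)
open import Relation.Binary.Construct.Closure.Transitive using (TransClosure)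

LPO : Set
LPO = (a : ℕ → Bool) → ((n : ℕ) → a n ≡ false) ⊎ ∃ λ n → a n ≡ true

TransClosureDecidable : Set₁
TransClosureDecidable =
  (R : Rel ℕ 0ℓ) → Decidable R → Decidable (TransClosure R)

module Submission where

-- (⇒) LPO decides every existential statement ∃ n. P n with P decidable
-- (`lpo-decides-∃`).  The transitive closure is such a statement: y R⁺ z
-- holds iff for some n the relation `Reach n y` holds, where `Reach n y`
-- says that y reaches z in at most n+1 steps through intermediate vertices
-- below n.  Each `Reach n` is decidable since all its quantifiers are
-- bounded (`reach?`), it is sound (`reach-sound`) and every path is caught
-- by some index (`reach-complete`).
--
-- (⇐) Given a : ℕ → Bool, the "ladder" relation has the steps x → x+1 and,
-- whenever a n = true, a jump from n+1 back to 0.  Then 1 R⁺ 0 holds iff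
-- some a n is true (`ladder-jump`, `ladder-witness`), so deciding this one
-- instance of the transitive closure decides the sequence a.

open import Defs
open import Level using (0ℓ)
open import Data.Bool using (Bool; true; false)
open import Data.Bool.Properties using (¬-not) renaming (_≟_ to _≟ᵇ_)
open import Data.Nat using (ℕ; zero; suc; pred; _+_; _<_; s≤s)
open import Data.Nat.Properties using (_≟_; m≤m+n; m<n⇒m<1+n; anyUpTo?)
open import Data.Product using (_×_; _,_; ∃)
open import Data.Sum using (_⊎_; inj₁; inj₂)
open import Relation.Nullary using (Dec; yes; no; ¬_; does; _×-dec_; _⊎-dec_)
open import Relation.Nullary.Decidable using (dec-true; map′)
open import Relation.Binary.PropositionalEquality using (_≡_; refl; trans; sym)
open import Relation.Binary.Core using (Rel)
open import Relation.Binary.Definitions using (Decidable)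
open import Relation.Binary.Construct.Closure.Transitive using (TransClosure; [_]; _∷_)

does-true : ∀ {p} {A : Set p} (A? : Dec A) → does A? ≡ true → A
does-true (yes a) refl = a

-- LPO decides the existential closure of any decidable predicate on ℕ:
-- apply it to the sequence of boolean verdicts.
lpo-decides-∃ : ∀ {p} → LPO → {P : ℕ → Set p} → (∀ n → Dec (P n)) → Dec (∃ P)
lpo-decides-∃ lpo P? with lpo (λ n → does (P? n))
... | inj₁ allFalse = no λ (n , pn) → falseNotTrue (trans (sym (allFalse n)) (dec-true (P? n) pn))
  where
  falseNotTrue : ¬ (false ≡ true)
  falseNotTrue ()
... | inj₂ (n , verdict) = yes (n , does-true (P? n) verdict)

module Approximation (R : Rel ℕ 0ℓ) (R? : Decidable R) (z : ℕ) where

  -- y reaches z in at most n+1 R-steps, all intermediate vertices below n.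
  Reach : ℕ → ℕ → Set
  Reach zero    y = R y z
  Reach (suc n) y = R y z ⊎ ∃ λ w → w < n × R y w × Reach n w

  reach? : ∀ n y → Dec (Reach n y)
  reach? zero    y = R? y z
  reach? (suc n) y = R? y z ⊎-dec anyUpTo? (λ w → R? y w ×-dec reach? n w) n

  reach-suc : ∀ n {y} → Reach n y → Reach (suc n) y
  reach-suc zero    r                         = inj₁ r
  reach-suc (suc n) (inj₁ r)                  = inj₁ r
  reach-suc (suc n) (inj₂ (w , w<n , r , d)) = inj₂ (w , m<n⇒m<1+n w<n , r , reach-suc n d)

  reach-+ : ∀ k {n y} → Reach n y → Reach (k + n) y
  reach-+ zero    d = d
  reach-+ (suc k) d = reach-suc _ (reach-+ k d)

  reach-sound : ∀ n {y} → Reach n y → TransClosure R y z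
  reach-sound zero    r                     = [ r ]
  reach-sound (suc n) (inj₁ r)              = [ r ]
  reach-sound (suc n) (inj₂ (_ , _ , r , d)) = r ∷ reach-sound n d

  -- Every path to z is caught by some approximation: for a first step
  -- y → w, enlarge the bound beyond both w and the index found for w.
  reach-complete : ∀ {y} → TransClosure R y z → ∃ λ n → Reach n y
  reach-complete [ r ] = 0 , r
  reach-complete (_∷_ {y = w} r path) with reach-complete path
  ... | n , d = suc (suc (w + n)) , inj₂ (w , s≤s (m≤m+n w n) , r , reach-+ (suc w) d)

lpo⇒transClosureDecidable : LPO → TransClosureDecidable
lpo⇒transClosureDecidable lpo R R? y z =
  map′ (λ (n , d) → reach-sound n d) reach-complete (lpo-decides-∃ lpo (λ n → reach? n y))
  where open Approximation R R? z

module Ladder (a : ℕ → Bool) where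

  Ladder : Rel ℕ 0ℓ
  Ladder x y = y ≡ suc x ⊎ (y ≡ 0 × a (pred x) ≡ true)

  ladder? : Decidable Ladder
  ladder? x y = (y ≟ suc x) ⊎-dec ((y ≟ 0) ×-dec (a (pred x) ≟ᵇ true))

  climb : ∀ n {y} → TransClosure Ladder (suc n) y → TransClosure Ladder 1 y
  climb zero    path = path
  climb (suc n) path = climb n (inj₁ refl ∷ path)

  ladder-jump : ∀ {n} → a n ≡ true → TransClosure Ladder 1 0
  ladder-jump {n} an = climb n [ inj₂ (refl , an) ]

  -- The last step of any path into 0 is a jump, which exhibits a true term.
  ladder-witness : ∀ {x} → TransClosure Ladder x 0 → ∃ λ n → a n ≡ true
  ladder-witness {x} [ inj₂ (_ , an) ] = pred x , an
  ladder-witness (_ ∷ path)           = ladder-witness path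

  ladder-decides : Dec (TransClosure Ladder 1 0) → ((n : ℕ) → a n ≡ false) ⊎ ∃ λ n → a n ≡ true
  ladder-decides (yes path)  = inj₂ (ladder-witness path)
  ladder-decides (no noPath) = inj₁ λ n → ¬-not λ an → noPath (ladder-jump an)

transClosureDecidable⇒lpo : TransClosureDecidable → LPO
transClosureDecidable⇒lpo tcd a = ladder-decides (tcd Ladder ladder? 1 0)
  where open Ladder a

proposition1p2p3 : (LPO → TransClosureDecidable) × (TransClosureDecidable → LPO)
proposition1p2p3 = lpo⇒transClosureDecidable , transClosureDecidable⇒lpo
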